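{- For all $f,g,h\in\mathcal T$, $$(f\ast g)\circ h=m\big((f\otimes g)\circ_2\delta(h)\big),$$ where $m:\mathcal T\otimes\mathcal T\to\mathcal T$ is the convolution product $m(a\otimes b)=a\ast b$ and $(a\otimes b)\circ_2(c\otimes d)=(a\circ c)\otimes(b\circ d)$. In Sweedler notation $\delta(h)=\sum h^{(1)}\otimes h^{(2)}$, this reads $(f\ast g)\circ h=\sum(f\circ h^{(1)})\ast(g\circ h^{(2)})$.
   Context: Let $\mathbf k$ be a field and $\mathcal P$ the set of finite subsets of the positive integers. $\mathcal T$ is the $\mathbf k$-vector space with basis the symbols $1_{(S_1,\dots,S_k)}$, $k\ge 0$, with $S_1,\dots,S_k\in\mathcal P$ nonempty and pairwise disjoint ($1_\emptyset$ for the empty sequence); a symbol containing empty sets means the same symbol with empty entries deleted. Products on basis elements: $1_{(S_1,\dots,S_n)}\ast 1_{(T_1,\dots,T_k)}=1_{(S_1,\dots,S_n,T_1,\dots,T_k)}$ if $(\bigcup S_i)\cap(\bigcup T_j)=\emptyset$ and $0$ otherwise; $1_{(S_1,\dots,S_n)}\circ 1_{(T_1,\dots,T_k)}=0$ if $\bigcup S_i\neq\bigcup T_j$, and otherwise $=1_{(S_1\cap T_1,\dots,S_1\cap T_k,\dots,S_n\cap T_1,\dots,S_n\cap T_k)}$. Coproduct: $\delta(1_{(S_1,\dots,S_k)})=\sum_{T_i\sqcup U_i=S_i}1_{(T_1,\dots,T_k)}\otimes 1_{(U_1,\dots,U_k)}$ (empty $T_i,U_i$ allowed). -}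

module Defs where

open import Level using (Level; _⊔_) renaming (suc to lsuc)
open import Algebra.Bundles using (CommutativeRing)
open import Data.Nat using (ℕ; _<_; _≡ᵇ_)
import Data.Nat as ℕ
open import Data.Bool using (Bool; true; false; if_then_else_; not; _∧_)
open import Data.List using (List; []; _∷_; _++_; map; concat; concatMap)
open import Data.Bool.ListAction using (all; any)
open import Data.List.Properties using (≡-dec)
open import Data.Maybe using (Maybe; just; nothing)
open import Data.Product using (_×_; _,_; ∃)
open import Data.Empty using (⊥)
open import Relation.Nullary using (¬_; yes; no)
open import Relation.Binary.PropositionalEquality using (_≡_; _≢_)
open import Data.List.Relation.Unary.All using (All)
open import Data.List.Relation.Unary.AllPairs using (AllPairs)
open import Data.List.Membership.Propositional using (_∈_)

record Field (c ℓ : Level) : Set (lsuc (c ⊔ ℓ)) where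
  field
    commutativeRing : CommutativeRing c ℓ
  open CommutativeRing commutativeRing public
  field
    0≉1     : ¬ (0# ≈ 1#)
    inverse : ∀ x → ¬ (x ≈ 0#) → ∃ λ y → x * y ≈ 1#

-- Finite subsets of the positive integers: strictly increasing lists of
-- positive naturals.  A basis symbol 1_(S₁,…,Sₖ) is a list of such sets.

FinSet : Set
FinSet = List ℕ

Key : Set
Key = List FinSet

ValidSet : FinSet → Set
ValidSet S = AllPairs _<_ S × All (0 <_) S × S ≢ []

Disjoint : FinSet → FinSet → Set
Disjoint S T = ∀ x → x ∈ S → x ∈ T → ⊥

ValidKey : Key → Set
ValidKey s = All ValidSet s × AllPairs Disjoint s

memb : ℕ → FinSet → Bool
memb x S = any (x ≡ᵇ_) S

inter : FinSet → FinSet → FinSet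
inter [] T = []
inter (x ∷ S) T = if memb x T then x ∷ inter S T else inter S T

sameSet : FinSet → FinSet → Bool
sameSet A B = all (λ x → memb x B) A ∧ all (λ x → memb x A) B

disjointB : FinSet → FinSet → Bool
disjointB A B = all (λ x → not (memb x B)) A

clean : Key → Key
clean [] = []
clean ([] ∷ s) = clean s
clean ((x ∷ S) ∷ s) = (x ∷ S) ∷ clean s

-- products of basis symbols (nothing = 0)
starKey : Key → Key → Maybe Key
starKey s t = if disjointB (concat s) (concat t) then just (clean (s ++ t)) else nothing

circKey : Key → Key → Maybe Key
circKey s t =
  if sameSet (concat s) (concat t)
  then just (clean (concatMap (λ S → map (inter S) t) s))
  else nothing

splits : FinSet → List (FinSet × FinSet)
splits [] = ([] , []) ∷ []
splits (x ∷ S) = concatMap (λ { (T , U) → (x ∷ T , U) ∷ (T , x ∷ U) ∷ [] }) (splits S)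

splitsKey : Key → List (Key × Key)
splitsKey [] = ([] , []) ∷ []
splitsKey (S ∷ s) =
  concatMap (λ { (T , U) → map (λ { (Ts , Us) → (T ∷ Ts , U ∷ Us) }) (splitsKey s) }) (splits S)

_≟K_ : (s t : Key) → Relation.Nullary.Dec (s ≡ t)
_≟K_ = ≡-dec (≡-dec ℕ._≟_)

-- The vector space 𝒯 over a field F (finite formal linear combinations of
-- basis symbols), 𝒯 ⊗ 𝒯, and the operations, extended (bi)linearly.

module TSpace {c ℓ : Level} (F : Field c ℓ) where
  open Field F

  𝒯 : Set c
  𝒯 = List (Carrier × Key)

  𝒯⊗𝒯 : Set c
  𝒯⊗𝒯 = List (Carrier × Key × Key)

  Valid : 𝒯 → Set c
  Valid f = All (λ { (_ , s) → ValidKey s }) f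

  coeff : 𝒯 → Key → Carrier
  coeff [] k = 0#
  coeff ((a , s) ∷ f) k with s ≟K k
  ... | yes _ = a + coeff f k
  ... | no  _ = coeff f k

  _≋_ : 𝒯 → 𝒯 → Set ℓ
  f ≋ g = ∀ k → coeff f k ≈ coeff g k

  scaled : Carrier → Maybe Key → 𝒯
  scaled a (just u) = (a , u) ∷ []
  scaled a nothing  = []

  _∗_ : 𝒯 → 𝒯 → 𝒯
  f ∗ g = concatMap (λ { (a , s) → concatMap (λ { (b , t) → scaled (a * b) (starKey s t) }) g }) f

  _∘_ : 𝒯 → 𝒯 → 𝒯
  f ∘ g = concatMap (λ { (a , s) → concatMap (λ { (b , t) → scaled (a * b) (circKey s t) }) g }) f

  _⊗_ : 𝒯 → 𝒯 → 𝒯⊗𝒯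
  f ⊗ g = concatMap (λ { (a , s) → map (λ { (b , t) → (a * b , s , t) }) g }) f

  δ : 𝒯 → 𝒯⊗𝒯
  δ h = concatMap (λ { (a , s) → map (λ { (T , U) → (a , clean T , clean U) }) (splitsKey s) }) h

  pair∘ : Carrier → Maybe Key → Maybe Key → 𝒯⊗𝒯
  pair∘ a (just u) (just v) = (a , u , v) ∷ []
  pair∘ a _ _ = []

  _∘₂_ : 𝒯⊗𝒯 → 𝒯⊗𝒯 → 𝒯⊗𝒯
  x ∘₂ y = concatMap (λ { (a , s₁ , s₂) → concatMap (λ { (b , t₁ , t₂) →
             pair∘ (a * b) (circKey s₁ t₁) (circKey s₂ t₂) }) y }) x

  m : 𝒯⊗𝒯 → 𝒯
  m x = concatMap (λ { (a , s , t) → scaled a (starKey s t) }) x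

{-# OPTIONS --safe #-}
module Submission where

-- Both sides are built from concatMaps, so they expand into sums over the terms
-- of f, g and h, and it suffices to compare, for basis symbols s, t, u (u with
-- disjoint blocks), the symbol (s ∗ t) ∘ u with the sum of (s ∘ L) ∗ (t ∘ R)
-- over all splittings Lᵢ ⊔ Rᵢ = Uᵢ of the blocks of u.  The term s ∘ L
-- vanishes unless ⋃ L = ⋃ s; as the blocks of u are disjoint, this leaves only
-- the split Lᵢ = Uᵢ ∩ ⋃ s, Rᵢ = Uᵢ ∖ ⋃ s.  For it, both sides are nonzero exactly
-- when ⋃ s and ⋃ t partition ⋃ u, and then they agree because a block of s
-- meets Uᵢ ∩ ⋃ s exactly where it meets Uᵢ.  The two sides are in fact equal
-- as formal sums, term by term.

open import Level using (Level)
open import Function.Base using (_∘′_)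
open import Function.Bundles using (_⇔_; mk⇔; Equivalence)
open import Function.Construct.Composition using (_⇔-∘_)
open import Function.Construct.Symmetry using (⇔-sym)
open import Data.Bool.Base using (Bool; true; false; T; not; if_then_else_)
open import Data.Bool.Properties using (T-≡; T-∧; ⇔→≡)
open import Data.Bool.ListAction using (all)
open import Data.Nat.Base using (ℕ)
open import Data.Nat.Properties using (≡ᵇ⇒≡; ≡⇒≡ᵇ; <⇒≢; _≟_)
open import Data.Product.Base using (_×_; _,_; proj₁; proj₂)
open import Data.Product.Function.NonDependent.Propositional using (_×-⇔_)
open import Data.Empty using (⊥-elim)
open import Data.Sum.Base using ([_,_])
open import Data.Unit.Base using (tt)
open import Data.Maybe.Base using (Maybe; just; nothing)
open import Data.List.Base using (List; []; _∷_; _++_; map; concat; concatMap; filter)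
open import Data.List.Properties
  using (++-identityʳ; concatMap-++; concatMap-map; concatMap-cong; concat-++; filter-++; map-∘; map-cong)
open import Data.List.Relation.Unary.All as All using (All; []; _∷_)
open import Data.List.Relation.Unary.All.Properties using (all-filter; all⁺; all⁻) renaming (++⁻ to All-++⁻)
open import Data.List.Relation.Unary.Any as Any using (here; there)
open import Data.List.Relation.Unary.Any.Properties using (any⁺; any⁻)
open import Data.List.Relation.Unary.AllPairs as AllPairs using (_∷_)
open import Data.List.Relation.Unary.Unique.Propositional using (Unique)
import Data.List.Relation.Unary.Unique.Propositional.Properties as Unique
open import Data.List.Relation.Ternary.Interleaving.Propositional
  using (Interleaving; []; consˡ; consʳ; toPermutation)
open import Data.List.Relation.Ternary.Interleaving.Propositional.Properties using (filter⁺)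
open import Data.List.Relation.Ternary.Interleaving.Properties using () renaming (++⁺ to Interleaving-++⁺)
open import Data.List.Membership.Propositional using (_∈_; _∉_)
open import Data.List.Membership.Propositional.Properties
  using (∈-++⁺ˡ; ∈-++⁺ʳ; ∈-++⁻; ∈-filter⁺; ∈-filter⁻; ∈-concat⁺′; ∈-concat⁻′; ∈-concatMap⁻; ∈-map⁻)
open import Data.List.Membership.DecPropositional _≟_ using (_∈?_)
open import Data.List.Relation.Binary.Subset.Propositional using (_⊆_)
open import Data.List.Relation.Binary.Subset.Propositional.Properties using (All-resp-⊇)
open import Data.List.Relation.Binary.Permutation.Propositional using (↭-sym)
open import Data.List.Relation.Binary.Permutation.Propositional.Properties using (∈-resp-↭)
open import Relation.Nullary using (¬_; yes; no)
open import Relation.Unary using (Pred; Decidable; ∁)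
open import Relation.Unary.Properties using (∁?)
open import Relation.Binary.PropositionalEquality
  using (_≡_; refl; sym; trans; cong; cong₂; subst; module ≡-Reasoning)

open import Defs

private variable
  a p : Level
  X Y Z : Set a

concatMap-concatMap : (g : Y → List Z) (f : X → List Y) (xs : List X) →
                      concatMap g (concatMap f xs) ≡ concatMap (concatMap g ∘′ f) xs
concatMap-concatMap g f []       = refl
concatMap-concatMap g f (x ∷ xs) =
  trans (concatMap-++ g (f x) (concatMap f xs)) (cong (concatMap g (f x) ++_) (concatMap-concatMap g f xs))

concatMap-cong-All : {P : Pred X p} {f g : X → List Y} {xs : List X} →
                     (∀ {x} → P x → f x ≡ g x) → All P xs → concatMap f xs ≡ concatMap g xs
concatMap-cong-All f≡g []         = refl
concatMap-cong-All f≡g (px ∷ pxs) = cong₂ _++_ (f≡g px) (concatMap-cong-All f≡g pxs)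

concatMap-const-[] : (xs : List X) → concatMap (λ _ → []) xs ≡ [] {A = Y}
concatMap-const-[] []       = refl
concatMap-const-[] (_ ∷ xs) = concatMap-const-[] xs

T-injective : ∀ {b b′} → T b ⇔ T b′ → b ≡ b′
T-injective eq = ⇔→≡ {z = true} (T-≡ ⇔-∘ (eq ⇔-∘ ⇔-sym T-≡))

T-not : ∀ b → T (not b) ⇔ (¬ T b)
T-not false = mk⇔ (λ _ ()) (λ _ → tt)
T-not true  = mk⇔ (λ ()) (λ ¬T → ¬T tt)

memb⇔∈ : ∀ {x} S → T (memb x S) ⇔ x ∈ S
memb⇔∈ S = mk⇔ (Any.map (≡ᵇ⇒≡ _ _) ∘′ any⁻ _ S) (any⁺ _ ∘′ Any.map (≡⇒≡ᵇ _ _))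

memb-cong : ∀ {x} S S′ → (x ∈ S ⇔ x ∈ S′) → memb x S ≡ memb x S′
memb-cong S S′ eq = T-injective (⇔-sym (memb⇔∈ S′) ⇔-∘ (eq ⇔-∘ memb⇔∈ S))

all-memb⇔⊆ : ∀ A B → T (all (λ x → memb x B) A) ⇔ A ⊆ B
all-memb⇔⊆ A B = mk⇔ to from
  where
  to : T (all (λ x → memb x B) A) → A ⊆ B
  to h x∈A = Equivalence.to (memb⇔∈ B) (All.lookup (all⁺ _ A h) x∈A)
  from : A ⊆ B → T (all (λ x → memb x B) A)
  from A⊆B = all⁻ _ (All.tabulate λ x∈A → Equivalence.from (memb⇔∈ B) (A⊆B x∈A))

_≐_ : FinSet → FinSet → Set
A ≐ B = A ⊆ B × B ⊆ A

sameSet⇔≐ : ∀ A B → T (sameSet A B) ⇔ A ≐ B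
sameSet⇔≐ A B = (all-memb⇔⊆ A B ×-⇔ all-memb⇔⊆ B A) ⇔-∘ T-∧

disjointB⇔Disjoint : ∀ A B → T (disjointB A B) ⇔ Disjoint A B
disjointB⇔Disjoint A B = mk⇔ to from
  where
  to : T (disjointB A B) → Disjoint A B
  to h x x∈A x∈B =
    Equivalence.to (T-not _) (All.lookup (all⁺ _ A h) x∈A) (Equivalence.from (memb⇔∈ B) x∈B)
  from : Disjoint A B → T (disjointB A B)
  from disj = all⁻ _ (All.tabulate λ x∈A →
    Equivalence.from (T-not _) (disj _ x∈A ∘′ Equivalence.to (memb⇔∈ B)))

module _ (A : FinSet) where

  private
    ∈A? : Decidable (_∈ A)
    ∈A? = _∈? A

  disjoint-union⇔filter : ∀ B C →
    (Disjoint A B × (A ++ B) ≐ C) ⇔ (A ≐ filter ∈A? C × B ≐ filter (∁? ∈A?) C)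
  disjoint-union⇔filter B C = mk⇔ to from
    where
    to : Disjoint A B × (A ++ B) ≐ C → A ≐ filter ∈A? C × B ≐ filter (∁? ∈A?) C
    to (disj , A++B⊆C , C⊆A++B) =
      ( (λ x∈A → ∈-filter⁺ ∈A? (A++B⊆C (∈-++⁺ˡ x∈A)) x∈A)
      , proj₂ ∘′ ∈-filter⁻ ∈A? {xs = C} )
      , ( (λ x∈B → ∈-filter⁺ (∁? ∈A?) (A++B⊆C (∈-++⁺ʳ A x∈B)) λ x∈A → disj _ x∈A x∈B)
        , λ x∈C∖A → let x∈C , x∉A = ∈-filter⁻ (∁? ∈A?) {xs = C} x∈C∖A in
            [ ⊥-elim ∘′ x∉A , (λ x∈B → x∈B) ] (∈-++⁻ A (C⊆A++B x∈C)) )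

    from : A ≐ filter ∈A? C × B ≐ filter (∁? ∈A?) C → Disjoint A B × (A ++ B) ≐ C
    from ((A⊆C∩A , C∩A⊆A) , (B⊆C∖A , C∖A⊆B)) = disj , A++B⊆C , C⊆A++B
      where
      disj : Disjoint A B
      disj x x∈A x∈B = proj₂ (∈-filter⁻ (∁? ∈A?) {xs = C} (B⊆C∖A x∈B)) x∈A

      A++B⊆C : A ++ B ⊆ C
      A++B⊆C = [ proj₁ ∘′ ∈-filter⁻ ∈A? {xs = C} ∘′ A⊆C∩A
               , proj₁ ∘′ ∈-filter⁻ (∁? ∈A?) {xs = C} ∘′ B⊆C∖A ] ∘′ ∈-++⁻ A

      C⊆A++B : C ⊆ A ++ B
      C⊆A++B {x} x∈C with x ∈? A
      ... | yes x∈A = ∈-++⁺ˡ (C∩A⊆A (∈-filter⁺ ∈A? x∈C x∈A))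
      ... | no  x∉A = ∈-++⁺ʳ A (C∖A⊆B (∈-filter⁺ (∁? ∈A?) x∈C x∉A))

module _ {l r xs : FinSet} (sp : Interleaving l r xs) where

  interleaving-⊆ˡ : l ⊆ xs
  interleaving-⊆ˡ = ∈-resp-↭ (↭-sym (toPermutation sp)) ∘′ ∈-++⁺ˡ

  interleaving-⊆ʳ : r ⊆ xs
  interleaving-⊆ʳ = ∈-resp-↭ (↭-sym (toPermutation sp)) ∘′ ∈-++⁺ʳ l

interleaving-disjoint : ∀ {l r xs} → Interleaving l r xs → Unique xs → Disjoint l r
interleaving-disjoint (consˡ sp) (x≢ ∷ _)  _ (here refl) x∈r         = All.lookup x≢ (interleaving-⊆ʳ sp x∈r) refl
interleaving-disjoint (consˡ sp) (_ ∷ uxs) x (there x∈l) x∈r         = interleaving-disjoint sp uxs x x∈l x∈r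
interleaving-disjoint (consʳ sp) (x≢ ∷ _)  _ x∈l         (here refl) = All.lookup x≢ (interleaving-⊆ˡ sp x∈l) refl
interleaving-disjoint (consʳ sp) (_ ∷ uxs) x x∈l         (there x∈r) = interleaving-disjoint sp uxs x x∈l x∈r

ValidKey⇒Unique : ∀ {u} → ValidKey u → Unique (concat u)
ValidKey⇒Unique (valid , disjoint) = Unique.concat⁺
  (All.map (AllPairs.map <⇒≢ ∘′ proj₁) valid)
  (AllPairs.map (λ disj {x} (x∈S , x∈S′) → disj x x∈S x∈S′) disjoint)

module _ {P : Pred ℕ p} (P? : Decidable P) where

  SplitBy : FinSet → FinSet → Set p
  SplitBy L R = All P L × All (∁ P) R

  SplitBy-++⁻ : ∀ L {L′} R {R′} → SplitBy (L ++ L′) (R ++ R′) → SplitBy L R × SplitBy L′ R′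
  SplitBy-++⁻ L R (pL , pR) with All-++⁻ L pL | All-++⁻ R pR
  ... | pL₁ , pL₂ | pR₁ , pR₂ = (pL₁ , pR₁) , (pL₂ , pR₂)

  concat-map-filter : (u : Key) → concat (map (filter P?) u) ≡ filter P? (concat u)
  concat-map-filter []      = refl
  concat-map-filter (S ∷ u) =
    trans (cong (filter P? S ++_) (concat-map-filter u)) (sym (filter-++ P? S (concat u)))

  concat-filter⁺ : (u : Key) →
    Interleaving (concat (map (filter P?) u)) (concat (map (filter (∁? P?)) u)) (concat u)
  concat-filter⁺ []      = []
  concat-filter⁺ (S ∷ u) = Interleaving-++⁺ (filter⁺ P? S) (concat-filter⁺ u)

  concatMap-splits : (F : FinSet × FinSet → List X) (S : FinSet) →
    (∀ {L R} → Interleaving L R S → ¬ SplitBy L R → F (L , R) ≡ []) →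
    concatMap F (splits S) ≡ F (filter P? S , filter (∁? P?) S)
  concatMap-splits F []      _        = ++-identityʳ _
  concatMap-splits F (x ∷ S) F-vanish = begin
    concatMap F (splits (x ∷ S))                    ≡⟨ concatMap-concatMap F _ (splits S) ⟩
    concatMap G (splits S)                          ≡⟨ concatMap-splits G S G-vanish ⟩
    G (filter P? S , filter (∁? P?) S)              ≡⟨ place-x ⟩
    F (filter P? (x ∷ S) , filter (∁? P?) (x ∷ S))  ∎
    where
    open ≡-Reasoning
    G : FinSet × FinSet → List _
    G (L , R) = F (x ∷ L , R) ++ F (L , x ∷ R) ++ []

    G-vanish : ∀ {L R : FinSet} → Interleaving L R S → ¬ SplitBy L R → G (L , R) ≡ []
    G-vanish sp ¬split = cong₂ _++_
      (F-vanish (consˡ sp) λ { (_ ∷ pL , pR) → ¬split (pL , pR) })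
      (cong (_++ []) (F-vanish (consʳ sp) λ { (pL , _ ∷ pR) → ¬split (pL , pR) }))

    place-x : G (filter P? S , filter (∁? P?) S) ≡ F (filter P? (x ∷ S) , filter (∁? P?) (x ∷ S))
    place-x with P? x
    ... | yes px = trans (cong (λ rest → F _ ++ rest ++ []) x-right-vanishes) (++-identityʳ _)
      where
      x-right-vanishes : F (filter P? S , x ∷ filter (∁? P?) S) ≡ []
      x-right-vanishes = F-vanish (consʳ (filter⁺ P? S)) λ { (_ , ¬px ∷ _) → ¬px px }
    ... | no ¬px = trans (cong (λ first → first ++ F _ ++ []) x-left-vanishes) (++-identityʳ _)
      where
      x-left-vanishes : F (x ∷ filter P? S , filter (∁? P?) S) ≡ []
      x-left-vanishes = F-vanish (consˡ (filter⁺ P? S)) λ { (px ∷ _ , _) → ¬px px }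

  concatMap-splitsKey : (F : Key × Key → List X) (u : Key) →
    (∀ {Ls Rs} → Interleaving (concat Ls) (concat Rs) (concat u) →
                 ¬ SplitBy (concat Ls) (concat Rs) → F (Ls , Rs) ≡ []) →
    concatMap F (splitsKey u) ≡ F (map (filter P?) u , map (filter (∁? P?)) u)
  concatMap-splitsKey F []      _        = ++-identityʳ _
  concatMap-splitsKey F (S ∷ u) F-vanish = begin
    concatMap F (splitsKey (S ∷ u))                             ≡⟨ concatMap-concatMap F _ (splits S) ⟩
    concatMap G (splits S)                                      ≡⟨ concatMap-splits G S G-vanish ⟩
    G (filter P? S , filter (∁? P?) S)                          ≡⟨ G-collapse (filter⁺ P? S) ⟩
    F (map (filter P?) (S ∷ u) , map (filter (∁? P?)) (S ∷ u))  ∎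
    where
    open ≡-Reasoning
    prepend : FinSet × FinSet → Key × Key → Key × Key
    prepend (L , R) (Ls , Rs) = L ∷ Ls , R ∷ Rs

    G : FinSet × FinSet → List _
    G LR = concatMap F (map (prepend LR) (splitsKey u))

    G-collapse : ∀ {L R : FinSet} → Interleaving L R S →
                 G (L , R) ≡ F (L ∷ map (filter P?) u , R ∷ map (filter (∁? P?)) u)
    G-collapse {L} {R} sp = trans (concatMap-map F (prepend (L , R)) (splitsKey u))
      (concatMap-splitsKey (F ∘′ prepend (L , R)) u λ sp′ ¬split →
        F-vanish (Interleaving-++⁺ sp sp′) (¬split ∘′ proj₂ ∘′ SplitBy-++⁻ L R))

    G-vanish : ∀ {L R : FinSet} → Interleaving L R S → ¬ SplitBy L R → G (L , R) ≡ []
    G-vanish {L} {R} sp ¬split = trans (G-collapse sp)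
      (F-vanish (Interleaving-++⁺ sp (concat-filter⁺ u)) (¬split ∘′ proj₁ ∘′ SplitBy-++⁻ L R))

interleaving-≐-SplitBy : ∀ {A l r xs} → Unique xs → Interleaving l r xs → A ≐ l → SplitBy (_∈? A) l r
interleaving-≐-SplitBy uxs sp (A⊆l , l⊆A) =
  All.tabulate l⊆A , All.tabulate λ x∈r x∈A → interleaving-disjoint sp uxs _ (A⊆l x∈A) x∈r

concat-clean : ∀ k → concat (clean k) ≡ concat k
concat-clean []            = refl
concat-clean ([] ∷ k)      = concat-clean k
concat-clean ((x ∷ S) ∷ k) = cong ((x ∷ S) ++_) (concat-clean k)

clean-++ : ∀ k l → clean (k ++ l) ≡ clean k ++ clean l
clean-++ []            l = refl
clean-++ ([] ∷ k)      l = clean-++ k l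
clean-++ ((x ∷ S) ∷ k) l = cong ((x ∷ S) ∷_) (clean-++ k l)

clean-idem : ∀ k → clean (clean k) ≡ clean k
clean-idem []            = refl
clean-idem ([] ∷ k)      = clean-idem k
clean-idem ((x ∷ S) ∷ k) = cong ((x ∷ S) ∷_) (clean-idem k)

clean-concatMap : (G : X → Key) (xs : List X) → clean (concatMap G xs) ≡ concatMap (clean ∘′ G) xs
clean-concatMap G []       = refl
clean-concatMap G (x ∷ xs) = trans (clean-++ (G x) _) (cong (clean (G x) ++_) (clean-concatMap G xs))

concatMap-clean : (H : FinSet → List X) → H [] ≡ [] → ∀ k → concatMap H (clean k) ≡ concatMap H k
concatMap-clean H H[]≡[] []            = refl
concatMap-clean H H[]≡[] ([] ∷ k)      =
  trans (concatMap-clean H H[]≡[] k) (cong (_++ concatMap H k) (sym H[]≡[]))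
concatMap-clean H H[]≡[] ((x ∷ S) ∷ k) = cong (H (x ∷ S) ++_) (concatMap-clean H H[]≡[] k)

clean-map-clean : (f : FinSet → FinSet) → f [] ≡ [] → ∀ k → clean (map f (clean k)) ≡ clean (map f k)
clean-map-clean f f[]≡[] []            = refl
clean-map-clean f f[]≡[] ([] ∷ k) rewrite f[]≡[] = clean-map-clean f f[]≡[] k
clean-map-clean f f[]≡[] ((x ∷ S) ∷ k) with f (x ∷ S)
... | []    = clean-map-clean f f[]≡[] k
... | y ∷ V = cong ((y ∷ V) ∷_) (clean-map-clean f f[]≡[] k)

clean-map-const-[] : (k : Key) → clean (map (λ _ → []) k) ≡ []
clean-map-const-[] []      = refl
clean-map-const-[] (_ ∷ k) = clean-map-const-[] k

inter-[]ʳ : ∀ S → inter S [] ≡ []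
inter-[]ʳ []      = refl
inter-[]ʳ (_ ∷ S) = inter-[]ʳ S

inter-⊆ʳ : ∀ S U → inter S U ⊆ U
inter-⊆ʳ (y ∷ S) U x∈ with memb y U in eq
inter-⊆ʳ (y ∷ S) U (here refl) | true = Equivalence.to (memb⇔∈ U) (Equivalence.from T-≡ eq)
inter-⊆ʳ (y ∷ S) U (there x∈)  | true = inter-⊆ʳ S U x∈
... | false = inter-⊆ʳ S U x∈

inter-filterʳ : {P : Pred ℕ p} (P? : Decidable P) → ∀ {S} U → All P S → inter S (filter P? U) ≡ inter S U
inter-filterʳ P? U []              = refl
inter-filterʳ P? U (_∷_ {x} px pS) = cong₂ (λ b V → if b then x ∷ V else V)
  (memb-cong (filter P? U) U (mk⇔ (proj₁ ∘′ ∈-filter⁻ P?) (λ x∈U → ∈-filter⁺ P? x∈U px)))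
  (inter-filterʳ P? U pS)

meet : Key → Key → Key
meet s u = clean (concatMap (λ S → map (inter S) u) s)

clean-meet : ∀ s u → clean (meet s u) ≡ meet s u
clean-meet s u = clean-idem (concatMap (λ S → map (inter S) u) s)

meet-rows : ∀ s u → meet s u ≡ concatMap (λ S → clean (map (inter S) u)) s
meet-rows s u = clean-concatMap _ s

meet-++ˡ : ∀ s t u → meet (s ++ t) u ≡ meet s u ++ meet t u
meet-++ˡ s t u = trans (cong clean (concatMap-++ rows s t)) (clean-++ (concatMap rows s) (concatMap rows t))
  where
  rows : FinSet → Key
  rows S = map (inter S) u

meet-cleanˡ : ∀ s u → meet (clean s) u ≡ meet s u
meet-cleanˡ s u = begin
  meet (clean s) u                                     ≡⟨ meet-rows (clean s) u ⟩
  concatMap (λ S → clean (map (inter S) u)) (clean s)  ≡⟨ concatMap-clean _ (clean-map-const-[] u) s ⟩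
  concatMap (λ S → clean (map (inter S) u)) s          ≡⟨ meet-rows s u ⟨
  meet s u                                             ∎
  where open ≡-Reasoning

meet-cleanʳ : ∀ s u → meet s (clean u) ≡ meet s u
meet-cleanʳ s u = begin
  meet s (clean u)                                     ≡⟨ meet-rows s (clean u) ⟩
  concatMap (λ S → clean (map (inter S) (clean u))) s  ≡⟨ concatMap-cong row-clean s ⟩
  concatMap (λ S → clean (map (inter S) u)) s          ≡⟨ meet-rows s u ⟨
  meet s u                                             ∎
  where
  open ≡-Reasoning
  row-clean : ∀ S → clean (map (inter S) (clean u)) ≡ clean (map (inter S) u)
  row-clean S = clean-map-clean (inter S) (inter-[]ʳ S) u

meet-filterʳ : {P : Pred ℕ p} (P? : Decidable P) → ∀ {s} u → All (All P) s →
               meet s (map (filter P?) u) ≡ meet s u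
meet-filterʳ P? {s} u pss = begin
  meet s (map (filter P?) u)                                     ≡⟨ meet-rows s _ ⟩
  concatMap (λ S → clean (map (inter S) (map (filter P?) u))) s  ≡⟨ concatMap-cong-All row-filter pss ⟩
  concatMap (λ S → clean (map (inter S) u)) s                    ≡⟨ meet-rows s u ⟨
  meet s u                                                       ∎
  where
  open ≡-Reasoning
  row-filter : ∀ {S} → All _ S → clean (map (inter S) (map (filter P?) u)) ≡ clean (map (inter S) u)
  row-filter pS = cong clean (trans (sym (map-∘ u)) (map-cong (λ U → inter-filterʳ P? U pS) u))

concat-meet-⊆ʳ : ∀ s u → concat (meet s u) ⊆ concat u
concat-meet-⊆ʳ s u x∈meet =
  let row , x∈row , row∈rows =
        ∈-concat⁻′ _ (subst (_ ∈_) (concat-clean (concatMap (λ S → map (inter S) u) s)) x∈meet)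
      S , row∈S∩u       = Any.satisfied (∈-concatMap⁻ (λ S → map (inter S) u) {xs = s} row∈rows)
      U , U∈u , row≡S∩U = ∈-map⁻ (inter S) row∈S∩u
  in ∈-concat⁺′ (inter-⊆ʳ S U (subst (_ ∈_) row≡S∩U x∈row)) U∈u

All-meet-filter : {P : Pred ℕ p} (P? : Decidable P) → ∀ s u →
                  All P (concat (meet s (clean (map (filter P?) u))))
All-meet-filter P? s u = All-resp-⊇ (concat-meet-⊆ʳ s _)
  (subst (All _) (sym (trans (concat-clean (map (filter P?) u)) (concat-map-filter P? u)))
         (all-filter P? (concat u)))

All-All-∈-concat : (v : List (List X)) → All (All (_∈ concat v)) v
All-All-∈-concat v = All.tabulate λ S∈v → All.tabulate λ x∈S → ∈-concat⁺′ x∈S S∈v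

starCircKey : Key → Key → Key → Maybe Key
starCircKey s t u = if disjointB (concat s) (concat t) then circKey (clean (s ++ t)) u else nothing

module CanonicalSplit (s t u : Key) where

  ∈s? : Decidable (_∈ concat s)
  ∈s? = _∈? concat s

  left right : Key
  left  = map (filter ∈s?) u
  right = map (filter (∁? ∈s?)) u

  star-circ-conditions :
    (T (disjointB (concat s) (concat t)) × T (sameSet (concat (clean (s ++ t))) (concat u)))
      ⇔ (T (sameSet (concat s) (concat (clean left))) × T (sameSet (concat t) (concat (clean right))))
  star-circ-conditions
    rewrite concat-clean (s ++ t) | sym (concat-++ s t) | concat-clean left | concat-clean right
          | concat-map-filter ∈s? u | concat-map-filter (∁? ∈s?) u
    = ⇔-sym (sameSet⇔≐ _ _ ×-⇔ sameSet⇔≐ _ _)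
        ⇔-∘ (disjoint-union⇔filter (concat s) (concat t) (concat u)
        ⇔-∘ (disjointB⇔Disjoint _ _ ×-⇔ sameSet⇔≐ _ _))

  meets-join : Disjoint (concat s) (concat t) →
               clean (meet s (clean left) ++ meet t (clean right)) ≡ meet (clean (s ++ t)) u
  meets-join disj = begin
    clean (meet s (clean left) ++ meet t (clean right))
      ≡⟨ clean-++ (meet s (clean left)) _ ⟩
    clean (meet s (clean left)) ++ clean (meet t (clean right))
      ≡⟨ cong₂ _++_ (clean-meet s (clean left)) (clean-meet t (clean right)) ⟩
    meet s (clean left) ++ meet t (clean right)
      ≡⟨ cong₂ _++_ (meet-cleanʳ s left) (meet-cleanʳ t right) ⟩
    meet s left ++ meet t right
      ≡⟨ cong₂ _++_ (meet-filterʳ ∈s? u (All-All-∈-concat s)) (meet-filterʳ (∁? ∈s?) u t-avoids-s) ⟩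
    meet s u ++ meet t u
      ≡⟨ meet-++ˡ s t u ⟨
    meet (s ++ t) u
      ≡⟨ meet-cleanˡ (s ++ t) u ⟨
    meet (clean (s ++ t)) u
      ∎
    where
    open ≡-Reasoning
    t-avoids-s : All (All (_∉ concat s)) t
    t-avoids-s = All.map (All.map λ x∈t x∈s → disj _ x∈s x∈t) (All-All-∈-concat t)

  meets-disjoint : Disjoint (concat (meet s (clean left))) (concat (meet t (clean right)))
  meets-disjoint x x∈X x∈Y =
    All.lookup (All-meet-filter (∁? ∈s?) t u) x∈Y (All.lookup (All-meet-filter ∈s? s u) x∈X)

module _ {c ℓ} (F : Field c ℓ) where
  open TSpace F
  open Field F using (_*_)

  guarded-terms-agree : ∀ e (d q q₁ q₂ : Bool) {K X Y} →
    ((T d × T q) ⇔ (T q₁ × T q₂)) → (T d → clean (X ++ Y) ≡ K) → T (disjointB (concat X) (concat Y)) →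
    scaled e (if d then (if q then just K else nothing) else nothing)
      ≡ m (pair∘ e (if q₁ then just X else nothing) (if q₂ then just Y else nothing))
  guarded-terms-agree e true  true  true  true  _     join disj rewrite Equivalence.to T-≡ disj | join _ = refl
  guarded-terms-agree e true  true  false _     conds _    _ = ⊥-elim (proj₁ (Equivalence.to conds _))
  guarded-terms-agree e true  true  true  false conds _    _ = ⊥-elim (proj₂ (Equivalence.to conds _))
  guarded-terms-agree e true  false true  true  conds _    _ = ⊥-elim (proj₂ (Equivalence.from conds _))
  guarded-terms-agree e false _     true  true  conds _    _ = ⊥-elim (proj₁ (Equivalence.from conds _))
  guarded-terms-agree e true  false true  false _     _    _ = refl
  guarded-terms-agree e true  false false _     _     _    _ = refl
  guarded-terms-agree e false _     true  false _     _    _ = refl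
  guarded-terms-agree e false _     false _     _     _    _ = refl

  basis-identity : ∀ s t u → ValidKey u → ∀ e →
    scaled e (starCircKey s t u)
      ≡ concatMap (λ (Ls , Rs) → m (pair∘ e (circKey s (clean Ls)) (circKey t (clean Rs)))) (splitsKey u)
  basis-identity s t u valid e = begin
    scaled e (starCircKey s t u)
      ≡⟨ guarded-terms-agree e _ _ _ _ star-circ-conditions
           (meets-join ∘′ Equivalence.to (disjointB⇔Disjoint _ _))
           (Equivalence.from (disjointB⇔Disjoint _ _) meets-disjoint) ⟩
    term (left , right)
      ≡⟨ concatMap-splitsKey ∈s? term u (λ {Ls} {Rs} → non-canonical-vanish {Ls} {Rs}) ⟨
    concatMap term (splitsKey u)
      ∎
    where
    open ≡-Reasoning
    open CanonicalSplit s t u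
    term : Key × Key → 𝒯
    term (Ls , Rs) = m (pair∘ e (circKey s (clean Ls)) (circKey t (clean Rs)))

    non-canonical-vanish : ∀ {Ls Rs} → Interleaving (concat Ls) (concat Rs) (concat u) →
                           ¬ SplitBy ∈s? (concat Ls) (concat Rs) → term (Ls , Rs) ≡ []
    non-canonical-vanish {Ls} sp ¬split with sameSet (concat s) (concat (clean Ls)) in eq
    ... | false = refl
    ... | true  = ⊥-elim (¬split (interleaving-≐-SplitBy (ValidKey⇒Unique valid) sp s≐Ls))
      where
      s≐Ls : concat s ≐ concat Ls
      s≐Ls = subst (concat s ≐_) (concat-clean Ls) (Equivalence.to (sameSet⇔≐ _ _) (Equivalence.from T-≡ eq))

  ∗-∘-expand : ∀ f g h → (f ∗ g) ∘ h ≡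
    concatMap (λ (a , s) → concatMap (λ (b , t) → scaled (a * b) (starKey s t) ∘ h) g) f
  ∗-∘-expand f g h = trans (concatMap-concatMap _ _ f) (concatMap-cong (λ _ → concatMap-concatMap _ _ g) f)

  ∘₂-singletonˡ : ∀ d s t y → ((d , s , t) ∷ []) ∘₂ y ≡
    concatMap (λ (b , Ls , Rs) → pair∘ (d * b) (circKey s Ls) (circKey t Rs)) y
  ∘₂-singletonˡ d s t y = ++-identityʳ _

  m-⊗-∘₂-expand : ∀ f g y → m ((f ⊗ g) ∘₂ y) ≡
    concatMap (λ (a , s) → concatMap (λ (b , t) → m (((a * b , s , t) ∷ []) ∘₂ y)) g) f
  m-⊗-∘₂-expand f g y =
    trans (concatMap-concatMap _ _ (f ⊗ g))
      (trans (concatMap-concatMap _ _ f)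
        (concatMap-cong (λ (a , s) → trans (concatMap-map _ _ g)
          (concatMap-cong (λ (b , t) → cong m (sym (∘₂-singletonˡ (a * b) s t y))) g)) f))

  scaled-starKey-∘ : ∀ d s t h →
    scaled d (starKey s t) ∘ h ≡ concatMap (λ (b , u) → scaled (d * b) (starCircKey s t u)) h
  scaled-starKey-∘ d s t h with disjointB (concat s) (concat t)
  ... | true  = ++-identityʳ _
  ... | false = sym (concatMap-const-[] h)

  m-∘₂-δ-expand : ∀ d s t h → m (((d , s , t) ∷ []) ∘₂ δ h) ≡
    concatMap (λ (b , u) →
      concatMap (λ (Ls , Rs) → m (pair∘ (d * b) (circKey s (clean Ls)) (circKey t (clean Rs)))) (splitsKey u)) h
  m-∘₂-δ-expand d s t h =
    trans (cong m (∘₂-singletonˡ d s t (δ h)))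
      (trans (concatMap-concatMap _ _ (δ h))
        (trans (concatMap-concatMap _ _ h) (concatMap-cong (λ (_ , u) → concatMap-map _ _ (splitsKey u)) h)))

  monomial-identity : ∀ {h} → Valid h → ∀ d s t →
                      scaled d (starKey s t) ∘ h ≡ m (((d , s , t) ∷ []) ∘₂ δ h)
  monomial-identity {h} valid d s t = begin
    scaled d (starKey s t) ∘ h
      ≡⟨ scaled-starKey-∘ d s t h ⟩
    concatMap (λ (b , u) → scaled (d * b) (starCircKey s t u)) h
      ≡⟨ concatMap-cong-All (λ {(b , u)} validᵤ → basis-identity s t u validᵤ (d * b)) valid ⟩
    _
      ≡⟨ m-∘₂-δ-expand d s t h ⟨
    m (((d , s , t) ∷ []) ∘₂ δ h)
      ∎
    where open ≡-Reasoning

  ∗-∘-≡-m-∘₂-δ : ∀ f g {h} → Valid h → (f ∗ g) ∘ h ≡ m ((f ⊗ g) ∘₂ δ h)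
  ∗-∘-≡-m-∘₂-δ f g {h} valid = begin
    (f ∗ g) ∘ h
      ≡⟨ ∗-∘-expand f g h ⟩
    concatMap (λ (a , s) → concatMap (λ (b , t) → scaled (a * b) (starKey s t) ∘ h) g) f
      ≡⟨ concatMap-cong (λ (a , s) → concatMap-cong (λ (b , t) → monomial-identity valid (a * b) s t) g) f ⟩
    concatMap (λ (a , s) → concatMap (λ (b , t) → m (((a * b , s , t) ∷ []) ∘₂ δ h)) g) f
      ≡⟨ m-⊗-∘₂-expand f g (δ h) ⟨
    m ((f ⊗ g) ∘₂ δ h)
      ∎
    where open ≡-Reasoning

mainTheorem8 : ∀ {c ℓ : Level} (F : Field c ℓ) → let open TSpace F in
                 (f g h : 𝒯) → Valid f → Valid g → Valid h →
                 ((f ∗ g) ∘ h) ≋ m ((f ⊗ g) ∘₂ δ h)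
mainTheorem8 F f g h _ _ valid k =
  Field.reflexive F (cong (λ z → TSpace.coeff F z k) (∗-∘-≡-m-∘₂-δ F f g valid))
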